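{- Let $k\geq 2$, let $G=(V,E)$ be a graph and let $uv\in E$. For every $k$-subset $S\subseteq V$ such that $G[S]$ is connected, $v\in S$ and $u\notin S$, there exists $v'\in S\setminus\{v\}$ such that $G[(S\setminus\{v'\})\cup\{u\}]$ is connected. -}

module Defs where

open import Data.Nat using (ℕ)
open import Data.Fin using (Fin)
open import Data.Fin.Subset using (Subset; _∈_)
open import Relation.Nullary using (¬_)
open import Relation.Binary using (Decidable)

record Graph (n : ℕ) : Set₁ where
  field
    Adj    : Fin n → Fin n → Set
    sym    : ∀ {x y} → Adj x y → Adj y x
    irrefl : ∀ {x} → ¬ Adj x x
    dec    : Decidable Adj

open Graph public

data WalkIn {n : ℕ} (G : Graph n) (S : Subset n) : Fin n → Fin n → Set where
  stop : ∀ {x} → x ∈ S → WalkIn G S x x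
  step : ∀ {x y z} → x ∈ S → Adj G x y → WalkIn G S y z → WalkIn G S x z

Connected : {n : ℕ} → Graph n → Subset n → Set
Connected G S = ∀ x y → x ∈ S → y ∈ S → WalkIn G S x y

-- Grow a set U ⊆ S outwards from v, one neighbour at a time, keeping every
-- vertex of U joined to v inside G[U]; since |S| ≥ 2 there is a first step.
-- When the vertex w just added makes U exhaust S, the set S ∖ {w} is the
-- previous U, so w is not a cut vertex of G[S], and w ≠ v as v ∈ U throughout.
-- Finally u joins S ∖ {w} through its neighbour v.
module Submission where

open import Defs
open import Data.Nat using (ℕ; _≤_; s≤s)
open import Data.Nat.Properties using (module ≤-Reasoning)
open import Data.Fin using (Fin)
open import Data.Fin.Properties using (any?)
open import Data.Fin.Subset
  using (Subset; _∈_; _∉_; _⊆_; _⊈_; _⊂_; _∪_; _─_; _-_; ⁅_⁆; ∣_∣; inside; outside)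
open import Data.Fin.Subset.Properties
  using ( _∈?_; x∈p∪q⁻; p⊆p∪q; q⊆p∪q; x∈⁅x⁆; x∈⁅y⁆⇒x≡y; x∉⁅y⁆⇒x≢y
        ; x∈p∧x≢y⇒x∈p-y; p─q⊆p; p⊆q⇒∣p∣≤∣q∣; ∣⁅x⁆∣≡1)
open import Data.Fin.Subset.Induction using (Acc; acc; ⊃-wellFounded)
open import Data.Vec using (_∷_; here; there)
open import Data.Product using (Σ; ∃; _×_; _,_)
open import Data.Sum using (_⊎_; inj₁; inj₂)
open import Data.Empty using (⊥-elim)
open import Relation.Nullary using (yes; no; ¬?)
open import Relation.Nullary.Decidable using (_×-dec_; decidable-stable)
open import Relation.Binary.PropositionalEquality using (_≡_; _≢_; refl)

x∈p─q⇒x∉q : ∀ {n} {x : Fin n} (p q : Subset n) → x ∈ p ─ q → x ∉ q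
x∈p─q⇒x∉q (_      ∷ p) (inside  ∷ q) () here
x∈p─q⇒x∉q (inside ∷ p) (outside ∷ q) here ()
x∈p─q⇒x∉q (_      ∷ p) (_       ∷ q) (there x∈p─q) (there x∈q) = x∈p─q⇒x∉q p q x∈p─q x∈q

x∈p⇒⁅x⁆⊆p : ∀ {n} {x : Fin n} {p : Subset n} → x ∈ p → ⁅ x ⁆ ⊆ p
x∈p⇒⁅x⁆⊆p {x = x} x∈p y∈⁅x⁆ with x∈⁅y⁆⇒x≡y x y∈⁅x⁆
... | refl = x∈p

2≤∣p∣⇒p⊈⁅x⁆ : ∀ {n} {x : Fin n} {p : Subset n} → 2 ≤ ∣ p ∣ → p ⊈ ⁅ x ⁆
2≤∣p∣⇒p⊈⁅x⁆ {x = x} {p} 2≤∣p∣ p⊆⁅x⁆ with 2≤1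
  where
  open ≤-Reasoning
  2≤1 : 2 ≤ 1
  2≤1 = begin 2 ≤⟨ 2≤∣p∣ ⟩ ∣ p ∣ ≤⟨ p⊆q⇒∣p∣≤∣q∣ p⊆⁅x⁆ ⟩ ∣ ⁅ x ⁆ ∣ ≡⟨ ∣⁅x⁆∣≡1 x ⟩ 1 ∎
... | s≤s ()

module _ {n : ℕ} (G : Graph n) where

  WalkIn-mono : ∀ {S T x y} → S ⊆ T → WalkIn G S x y → WalkIn G T x y
  WalkIn-mono S⊆T (stop x∈S)         = stop (S⊆T x∈S)
  WalkIn-mono S⊆T (step x∈S x~y walk) = step (S⊆T x∈S) x~y (WalkIn-mono S⊆T walk)

  WalkIn-source : ∀ {S x y} → WalkIn G S x y → x ∈ S
  WalkIn-source (stop x∈S)     = x∈S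
  WalkIn-source (step x∈S _ _) = x∈S

  WalkIn-trans : ∀ {S x y z} → WalkIn G S x y → WalkIn G S y z → WalkIn G S x z
  WalkIn-trans (stop _)            walk′ = walk′
  WalkIn-trans (step x∈S x~y walk) walk′ = step x∈S x~y (WalkIn-trans walk walk′)

  WalkIn-sym : ∀ {S x y} → WalkIn G S x y → WalkIn G S y x
  WalkIn-sym (stop x∈S)          = stop x∈S
  WalkIn-sym (step x∈S x~y walk) =
    WalkIn-trans (WalkIn-sym walk) (step (WalkIn-source walk) (sym G x~y) (stop x∈S))

  RootedAt : Subset n → Fin n → Set
  RootedAt S v = ∀ x → x ∈ S → WalkIn G S x v

  rooted⇒connected : ∀ {S v} → RootedAt S v → Connected G S
  rooted⇒connected rooted x y x∈S y∈S = WalkIn-trans (rooted x x∈S) (WalkIn-sym (rooted y y∈S))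

  rooted-⁅⁆ : ∀ v → RootedAt ⁅ v ⁆ v
  rooted-⁅⁆ v x x∈⁅v⁆ with x∈⁅y⁆⇒x≡y v x∈⁅v⁆
  ... | refl = stop x∈⁅v⁆

  rooted-∪-neighbour : ∀ {U v x y} → RootedAt U v → y ∈ U → Adj G x y → RootedAt (U ∪ ⁅ x ⁆) v
  rooted-∪-neighbour {U} {x = x} {y} rooted y∈U x~y z z∈U∪x with x∈p∪q⁻ U ⁅ x ⁆ z∈U∪x
  ... | inj₁ z∈U = WalkIn-mono (p⊆p∪q _) (rooted z z∈U)
  ... | inj₂ z∈⁅x⁆ with x∈⁅y⁆⇒x≡y x z∈⁅x⁆
  ...   | refl = step z∈U∪x x~y (WalkIn-mono (p⊆p∪q _) (rooted y y∈U))

  record Exit (S U : Subset n) : Set where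
    field
      outer   : Fin n
      inner   : Fin n
      outer∈S : outer ∈ S
      outer∉U : outer ∉ U
      inner∈U : inner ∈ U
      adj     : Adj G outer inner

  walk⇒exit : ∀ {S U a b} → WalkIn G S a b → a ∉ U → b ∈ U → Exit S U
  walk⇒exit (stop _) a∉U a∈U = ⊥-elim (a∉U a∈U)
  walk⇒exit {U = U} (step {y = c} a∈S a~c walk) a∉U b∈U with c ∈? U
  ... | yes c∈U = record { outer∈S = a∈S ; outer∉U = a∉U ; inner∈U = c∈U ; adj = a~c }
  ... | no  c∉U = walk⇒exit walk c∉U b∈U

  exit-or-⊆ : ∀ {S U v} → Connected G S → v ∈ S → v ∈ U → Exit S U ⊎ S ⊆ U
  exit-or-⊆ {S} {U} {v} conn v∈S v∈U with any? (λ a → (a ∈? S) ×-dec ¬? (a ∈? U))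
  ... | yes (a , a∈S , a∉U) = inj₁ (walk⇒exit (conn a v a∈S v∈S) a∉U v∈U)
  ... | no ∄a = inj₂ λ {a} a∈S → decidable-stable (a ∈? U) (λ a∉U → ∄a (a , a∈S , a∉U))

  non-cut-vertex-outside : ∀ {S U v} → Connected G S → v ∈ U → U ⊆ S → RootedAt U v → Exit S U →
                           ∃ λ w → w ∈ S × w ∉ U × RootedAt (S - w) v
  non-cut-vertex-outside {S} {v = v} conn = grow (⊃-wellFounded _)
    where
    grow : ∀ {U} → Acc _ U → v ∈ U → U ⊆ S → RootedAt U v → Exit S U →
           ∃ λ w → w ∈ S × w ∉ U × RootedAt (S - w) v
    grow {U} (acc larger) v∈U U⊆S rooted exit =
      extend (exit-or-⊆ conn (U⊆S v∈U) (p⊆p∪q _ v∈U))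
      where
      open Exit exit renaming (outer to x)

      U⊂U∪x : U ⊂ U ∪ ⁅ x ⁆
      U⊂U∪x = p⊆p∪q _ , x , q⊆p∪q U ⁅ x ⁆ (x∈⁅x⁆ x) , outer∉U

      U∪x⊆S : U ∪ ⁅ x ⁆ ⊆ S
      U∪x⊆S z∈U∪x with x∈p∪q⁻ U ⁅ x ⁆ z∈U∪x
      ... | inj₁ z∈U   = U⊆S z∈U
      ... | inj₂ z∈⁅x⁆ = x∈p⇒⁅x⁆⊆p outer∈S z∈⁅x⁆

      U⊆S-x : U ⊆ S - x
      U⊆S-x z∈U = x∈p∧x≢y⇒x∈p-y (U⊆S z∈U) λ { refl → outer∉U z∈U }

      S-x⊆U : S ⊆ U ∪ ⁅ x ⁆ → S - x ⊆ U
      S-x⊆U S⊆U∪x {z} z∈S-x with x∈p∪q⁻ U ⁅ x ⁆ (S⊆U∪x (p─q⊆p S ⁅ x ⁆ z∈S-x))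
      ... | inj₁ z∈U   = z∈U
      ... | inj₂ z∈⁅x⁆ = ⊥-elim (x∈p─q⇒x∉q S ⁅ x ⁆ z∈S-x z∈⁅x⁆)

      extend : Exit S (U ∪ ⁅ x ⁆) ⊎ S ⊆ U ∪ ⁅ x ⁆ → ∃ λ w → w ∈ S × w ∉ U × RootedAt (S - w) v
      extend (inj₂ S⊆U∪x) =
        x , outer∈S , outer∉U , λ z z∈S-x → WalkIn-mono U⊆S-x (rooted z (S-x⊆U S⊆U∪x z∈S-x))
      extend (inj₁ exit′)
        with grow (larger U⊂U∪x) (p⊆p∪q _ v∈U) U∪x⊆S (rooted-∪-neighbour rooted inner∈U adj) exit′
      ... | w , w∈S , w∉U∪x , rooted-S-w = w , w∈S , (λ w∈U → w∉U∪x (p⊆p∪q _ w∈U)) , rooted-S-w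

  non-cut-vertex : ∀ {S v} → 2 ≤ ∣ S ∣ → Connected G S → v ∈ S →
                   ∃ λ w → w ∈ S × w ≢ v × RootedAt (S - w) v
  non-cut-vertex {S} {v} 2≤∣S∣ conn v∈S with exit-or-⊆ conn v∈S (x∈⁅x⁆ v)
  ... | inj₂ S⊆⁅v⁆ = ⊥-elim (2≤∣p∣⇒p⊈⁅x⁆ 2≤∣S∣ S⊆⁅v⁆)
  ... | inj₁ exit
    with non-cut-vertex-outside conn (x∈⁅x⁆ v) (x∈p⇒⁅x⁆⊆p v∈S) (rooted-⁅⁆ v) exit
  ...   | w , w∈S , w∉⁅v⁆ , rooted = w , w∈S , x∉⁅y⁆⇒x≢y w∉⁅v⁆ , rooted

-- The hypothesis u ∉ S only serves to keep the new set of size k, which the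
-- conclusion does not record.
proposition3 : (n k : ℕ) → 2 ≤ k → (G : Graph n) → (u v : Fin n) → Adj G u v →
    (S : Subset n) → ∣ S ∣ ≡ k → Connected G S → v ∈ S → u ∉ S →
    Σ (Fin n) (λ v′ → v′ ∈ S × v′ ≢ v × Connected G ((S - v′) ∪ ⁅ u ⁆))
proposition3 n k 2≤k G u v u~v S refl conn v∈S _ with non-cut-vertex G 2≤k conn v∈S
... | w , w∈S , w≢v , rooted =
  w , w∈S , w≢v , rooted⇒connected G (rooted-∪-neighbour G rooted v∈S-w u~v)
  where
  v∈S-w : v ∈ S - w
  v∈S-w = x∈p∧x≢y⇒x∈p-y v∈S λ { refl → w≢v refl }
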